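{- Let $u \in \mathcal{A}^*$ and $i \in \mathbb{N}$. Then $\ddot e_i(u)$ is defined if and only if $\mathrm{rtree}(u)$ contains at least one node labelled $i+1$ but does not contain a node labelled $i+1$ in the right subtree of the topmost node labelled $i$.
   Context: $\mathcal{A} = \{1,2,3,\ldots\}$ with the usual order; $\mathcal{A}^*$ the free monoid over $\mathcal{A}$. Quasi-Kashiwara raising operator $\ddot e_i$: if $u$ contains a letter $i+1$ somewhere to the left of a letter $i$, $\ddot e_i(u)$ is undefined; otherwise $\ddot e_i(u)$ is obtained by replacing the leftmost letter $i+1$ in $u$ by $i$, and is undefined if $u$ contains no letter $i+1$. $\mathrm{rtree}(a_1\cdots a_k)$ is the right strict binary search tree (each node's label $\ge$ all labels in its left subtree and $<$ all labels in its right subtree) obtained from the empty tree by inserting $a_k,a_{k-1},\ldots,a_1$ in turn, where inserting $a$ creates a node labelled $a$ at an empty position and otherwise recurses into the left subtree if $a \le$ the root label and into the right subtree otherwise. The topmost node labelled $i$ is the node labelled $i$ closest to the root (if $\mathrm{rtree}(u)$ has no node labelled $i$, the condition about its right subtree is vacuous). -}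

module Defs where

open import Data.Nat using (ℕ; zero; suc; _≤_; _<_; _≤ᵇ_; _≡ᵇ_)
open import Data.Bool using (Bool; true; false; if_then_else_)
open import Data.List using (List; []; _∷_; foldr)
open import Data.Maybe using (Maybe; just; nothing; map)
open import Data.Product using (Σ; _×_)
open import Data.Sum using (_⊎_)
open import Data.Empty using (⊥)
open import Relation.Binary.PropositionalEquality using (_≡_)
open import Data.List.Membership.Propositional using (_∈_)
open import Data.Nat using (_⊓_)

-- Words over A = {1,2,3,...} are lists of naturals (positivity imposed in the statement).
Word : Set
Word = List ℕ

data LeftOf (a b : ℕ) : Word → Set where
  here  : ∀ {x u} → x ≡ a → b ∈ u → LeftOf a b (x ∷ u)
  there : ∀ {x u} → LeftOf a b u → LeftOf a b (x ∷ u)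

replaceLeftmost : ℕ → ℕ → Word → Maybe Word
replaceLeftmost a b []      = nothing
replaceLeftmost a b (x ∷ u) =
  if x ≡ᵇ a then just (b ∷ u) else map (x ∷_) (replaceLeftmost a b u)

-- quasi-Kashiwara raising operator ë_i as a partial function:
-- ë_i(u) = w  is expressed by  Ëi i u w
data Ë (i : ℕ) (u : Word) : Word → Set where
  defined : ∀ {w} → (LeftOf (suc i) i u → ⊥) → replaceLeftmost (suc i) i u ≡ just w → Ë i u w

ËDefined : ℕ → Word → Set
ËDefined i u = Σ Word (Ë i u)

data Tree : Set where
  leaf : Tree
  node : Tree → ℕ → Tree → Tree

insert : ℕ → Tree → Tree
insert a leaf         = node leaf a leaf
insert a (node l x r) = if a ≤ᵇ x then node (insert a l) x r else node l x (insert a r)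

rtree : Word → Tree
rtree = foldr insert leaf

data Contains (a : ℕ) : Tree → Set where
  root  : ∀ {l r} → Contains a (node l a r)
  inL   : ∀ {l x r} → Contains a l → Contains a (node l x r)
  inR   : ∀ {l x r} → Contains a r → Contains a (node l x r)

depthOf : ℕ → Tree → Maybe ℕ
depthOf a leaf = nothing
depthOf a (node l x r) with x ≡ᵇ a
... | true  = just 0
... | false = Data.Maybe.map suc (minM (depthOf a l) (depthOf a r))
  where
  minM : Maybe ℕ → Maybe ℕ → Maybe ℕ
  minM (just m) (just n) = just (m ⊓ n)
  minM (just m) nothing  = just m
  minM nothing  n        = n

data RightSubAt (a : ℕ) : ℕ → Tree → Tree → Set where
  root : ∀ {l r} → RightSubAt a zero (node l a r) r
  inL  : ∀ {d l x r s} → RightSubAt a d l s → RightSubAt a (suc d) (node l x r) s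
  inR  : ∀ {d l x r s} → RightSubAt a d r s → RightSubAt a (suc d) (node l x r) s

-- t contains a node labelled b in the right subtree of the topmost node labelled a
-- (vacuously false if t has no node labelled a)
BInRightOfTop : ℕ → ℕ → Tree → Set
BInRightOfTop b a t =
  Σ ℕ λ d → Σ Tree λ s → depthOf a t ≡ just d × RightSubAt a d t s × Contains b s

-- Since rtree inserts the letters of u from right to left, the topmost node
-- labelled i is the rightmost i of u, and it is the node reached by binary
-- search for i.  A letter i + 1 compares like i with every other label, so an
-- i + 1 inserted after that node ends up in its right subtree, and that
-- subtree only receives letters inserted after it.  Hence the right subtree of
-- the topmost i contains an i + 1 exactly when some i + 1 stands to the left
-- of an i in u, which is what makes ë_i(u) undefined.

module Submission where

open import Defs
open import Data.Nat using (ℕ; suc; _≤_; _≰_; _≤ᵇ_; _≡ᵇ_; _≟_; _≤?_)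
open import Data.Nat.Properties
  using (≡ᵇ⇒≡; ≡⇒≡ᵇ; ≤ᵇ⇒≤; ≤⇒≤ᵇ; ≤-trans; n≤1+n; n<1+n; ≤∧≢⇒<; <⇒≱)
open import Data.Bool using (true; false; T; if_then_else_)
open import Data.Bool.Properties using (T-≡)
open import Data.Empty using (⊥-elim)
open import Data.List using ([]; _∷_)
open import Data.List.Relation.Unary.All using (All)
open import Data.List.Relation.Unary.Any using (here; there)
open import Data.List.Membership.Propositional using (_∈_)
open import Data.Maybe using (Maybe; just; nothing; map)
open import Data.Product using (∃; _×_; _,_)
open import Data.Product.Function.NonDependent.Propositional using (_×-⇔_)
open import Data.Sum using (_⊎_; inj₁; inj₂; [_,_])
open import Function using (_∘_; id)
open import Function.Bundles using (_⇔_; mk⇔; Equivalence)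
open import Function.Construct.Composition using (_⇔-∘_)
open import Function.Construct.Identity using (⇔-id)
open import Function.Construct.Symmetry using (⇔-sym)
open import Function.Related.TypeIsomorphisms using (¬-cong-⇔)
open import Relation.Nullary using (¬_; yes; no)
open import Relation.Binary.PropositionalEquality using (_≡_; _≢_; refl; sym; trans; cong)

private
  variable
    a b i x : ℕ
    l r s t : Tree
    u : Word

¬T⇒≡false : ∀ {c} → ¬ T c → c ≡ false
¬T⇒≡false {false} _ = refl
¬T⇒≡false {true}  ¬t = ⊥-elim (¬t _)

≡ᵇ-refl : ∀ n → (n ≡ᵇ n) ≡ true
≡ᵇ-refl n = Equivalence.to T-≡ (≡⇒≡ᵇ n n refl)

≢⇒≡ᵇ-false : ∀ {m n} → m ≢ n → (m ≡ᵇ n) ≡ false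
≢⇒≡ᵇ-false {m} {n} m≢n = ¬T⇒≡false (m≢n ∘ ≡ᵇ⇒≡ m n)

≤⇒≤ᵇ-true : ∀ {m n} → m ≤ n → (m ≤ᵇ n) ≡ true
≤⇒≤ᵇ-true = Equivalence.to T-≡ ∘ ≤⇒≤ᵇ

≰⇒≤ᵇ-false : ∀ {m n} → m ≰ n → (m ≤ᵇ n) ≡ false
≰⇒≤ᵇ-false {m} {n} m≰n = ¬T⇒≡false (m≰n ∘ ≤ᵇ⇒≤ m n)

insert-≤ : ∀ l r → a ≤ x → insert a (node l x r) ≡ node (insert a l) x r
insert-≤ _ _ a≤x rewrite ≤⇒≤ᵇ-true a≤x = refl

insert-≰ : ∀ l r → a ≰ x → insert a (node l x r) ≡ node l x (insert a r)
insert-≰ _ _ a≰x rewrite ≰⇒≤ᵇ-false a≰x = refl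

Contains-insert : ∀ t → Contains b (insert a t) ⇔ (b ≡ a ⊎ Contains b t)
Contains-insert t = mk⇔ (to t) (from t)
  where
  to : ∀ t → Contains b (insert a t) → b ≡ a ⊎ Contains b t
  to leaf root = inj₁ refl
  to {a = a} (node l x r) c with a ≤? x
  ... | yes a≤x rewrite insert-≤ l r a≤x = go c
    where
    go : Contains _ (node (insert a l) x r) → _
    go root    = inj₂ root
    go (inL c) = [ inj₁ , inj₂ ∘ inL ] (to l c)
    go (inR c) = inj₂ (inR c)
  ... | no a≰x rewrite insert-≰ l r a≰x = go c
    where
    go : Contains _ (node l x (insert a r)) → _
    go root    = inj₂ root
    go (inL c) = inj₂ (inL c)
    go (inR c) = [ inj₁ , inj₂ ∘ inR ] (to r c)
  from : ∀ t → b ≡ a ⊎ Contains b t → Contains b (insert a t)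
  from leaf (inj₁ refl) = root
  from {a = a} (node l x r) h with a ≤? x
  ... | yes a≤x rewrite insert-≤ l r a≤x = go h
    where
    go : _ ⊎ Contains _ (node l x r) → Contains _ (node (insert a l) x r)
    go (inj₁ b≡a)  = inL (from l (inj₁ b≡a))
    go (inj₂ root)    = root
    go (inj₂ (inL c)) = inL (from l (inj₂ c))
    go (inj₂ (inR c)) = inR c
  ... | no a≰x rewrite insert-≰ l r a≰x = go h
    where
    go : _ ⊎ Contains _ (node l x r) → Contains _ (node l x (insert a r))
    go (inj₁ b≡a)  = inR (from r (inj₁ b≡a))
    go (inj₂ root)    = root
    go (inj₂ (inL c)) = inL c
    go (inj₂ (inR c)) = inR (from r (inj₂ c))

Contains-insert-other : b ≢ a → ∀ t → Contains b (insert a t) ⇔ Contains b t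
Contains-insert-other b≢a t = mk⇔
  ([ ⊥-elim ∘ b≢a , id ] ∘ Equivalence.to (Contains-insert t))
  (Equivalence.from (Contains-insert t) ∘ inj₂)

rtree-Contains : Contains a (rtree u) ⇔ a ∈ u
rtree-Contains {u = u} = mk⇔ (to u) (from u)
  where
  to : ∀ u → Contains a (rtree u) → a ∈ u
  to (x ∷ u) c = [ here , there ∘ to u ] (Equivalence.to (Contains-insert (rtree u)) c)
  from : ∀ u → a ∈ u → Contains a (rtree u)
  from (x ∷ u) (here a≡x)  = Equivalence.from (Contains-insert (rtree u)) (inj₁ a≡x)
  from (x ∷ u) (there a∈u) = Equivalence.from (Contains-insert (rtree u)) (inj₂ (from u a∈u))

searchRight : ℕ → Tree → Maybe Tree
searchRight i leaf         = nothing
searchRight i (node l x r) =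
  if x ≡ᵇ i then just r else if i ≤ᵇ x then searchRight i l else searchRight i r

searchRight-here : ∀ i l r → searchRight i (node l i r) ≡ just r
searchRight-here i _ _ rewrite ≡ᵇ-refl i = refl

searchRight-left : ∀ l r → x ≢ i → i ≤ x → searchRight i (node l x r) ≡ searchRight i l
searchRight-left _ _ x≢i i≤x rewrite ≢⇒≡ᵇ-false x≢i | ≤⇒≤ᵇ-true i≤x = refl

searchRight-right : ∀ l r → x ≢ i → i ≰ x → searchRight i (node l x r) ≡ searchRight i r
searchRight-right _ _ x≢i i≰x rewrite ≢⇒≡ᵇ-false x≢i | ≰⇒≤ᵇ-false i≰x = refl

-- Every node labelled i lies on the search path for i.
data SearchTree (i : ℕ) : Tree → Set where
  leaf  : SearchTree i leaf
  here  : SearchTree i (node l i r)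
  left  : x ≢ i → i ≤ x → ¬ Contains i r → SearchTree i l → SearchTree i (node l x r)
  right : x ≢ i → i ≰ x → ¬ Contains i l → SearchTree i r → SearchTree i (node l x r)

insert-SearchTree : ∀ a t → SearchTree i t → SearchTree i (insert a t)
insert-SearchTree {i} a leaf leaf with a ≟ i | i ≤? a
... | yes refl | _       = here
... | no a≢i   | yes i≤a = left a≢i i≤a (λ ()) leaf
... | no a≢i   | no i≰a  = right a≢i i≰a (λ ()) leaf
insert-SearchTree a (node l x r) st with a ≤? x | st
... | yes a≤x | here  rewrite insert-≤ l r a≤x = here
... | no  a≰x | here  rewrite insert-≰ l r a≰x = here
... | yes a≤x | left x≢i i≤x i∉r stl rewrite insert-≤ l r a≤x =
  left x≢i i≤x i∉r (insert-SearchTree a l stl)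
... | no  a≰x | left x≢i i≤x i∉r stl rewrite insert-≰ l r a≰x =
  left x≢i i≤x ([ (λ { refl → a≰x i≤x }) , i∉r ] ∘ Equivalence.to (Contains-insert r))
       stl
... | yes a≤x | right x≢i i≰x i∉l str rewrite insert-≤ l r a≤x =
  right x≢i i≰x ([ (λ { refl → i≰x a≤x }) , i∉l ] ∘ Equivalence.to (Contains-insert l))
        str
... | no  a≰x | right x≢i i≰x i∉l str rewrite insert-≰ l r a≰x =
  right x≢i i≰x i∉l (insert-SearchTree a r str)

rtree-SearchTree : ∀ u → SearchTree i (rtree u)
rtree-SearchTree []      = leaf
rtree-SearchTree (x ∷ u) = insert-SearchTree x (rtree u) (rtree-SearchTree u)

depthOf-absent : ¬ Contains a t → depthOf a t ≡ nothing
depthOf-absent {t = leaf}       _   = refl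
depthOf-absent {a} {node l x r} a∉t with x ≟ a
... | yes refl = ⊥-elim (a∉t root)
... | no x≢a rewrite ≢⇒≡ᵇ-false x≢a | depthOf-absent (a∉t ∘ inL) | depthOf-absent (a∉t ∘ inR) =
  refl

depthOf-here : ∀ i l r → depthOf i (node l i r) ≡ just 0
depthOf-here i _ _ rewrite ≡ᵇ-refl i = refl

depthOf-left : ∀ l r → x ≢ i → ¬ Contains i r → depthOf i (node l x r) ≡ map suc (depthOf i l)
depthOf-left {i = i} l _ x≢i i∉r rewrite ≢⇒≡ᵇ-false x≢i | depthOf-absent i∉r with depthOf i l
... | just _  = refl
... | nothing = refl

depthOf-right : ∀ l r → x ≢ i → ¬ Contains i l → depthOf i (node l x r) ≡ map suc (depthOf i r)
depthOf-right _ _ x≢i i∉l rewrite ≢⇒≡ᵇ-false x≢i | depthOf-absent i∉l = refl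

RightSubAt-Contains : ∀ {d} → RightSubAt a d t s → Contains a t
RightSubAt-Contains root    = root
RightSubAt-Contains (inL p) = inL (RightSubAt-Contains p)
RightSubAt-Contains (inR p) = inR (RightSubAt-Contains p)

map-suc-just : ∀ {m d} → map suc m ≡ just (suc d) → m ≡ just d
map-suc-just {just _} refl = refl

searchRight-complete : ∀ {d} → SearchTree i t → depthOf i t ≡ just d → RightSubAt i d t s →
                       searchRight i t ≡ just s
searchRight-complete {i} {node l _ r} here _ root = searchRight-here i l r
searchRight-complete {i} {node l _ r} here de (inL _) with () ← trans (sym de) (depthOf-here i l r)
searchRight-complete {i} {node l _ r} here de (inR _) with () ← trans (sym de) (depthOf-here i l r)
searchRight-complete (left x≢i _ _ _) _ root = ⊥-elim (x≢i refl)
searchRight-complete {t = node l _ r} (left x≢i i≤x i∉r st) de (inL p) =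
  trans (searchRight-left l r x≢i i≤x)
        (searchRight-complete st (map-suc-just (trans (sym (depthOf-left l r x≢i i∉r)) de)) p)
searchRight-complete (left _ _ i∉r _) _ (inR p) = ⊥-elim (i∉r (RightSubAt-Contains p))
searchRight-complete (right x≢i _ _ _) _ root = ⊥-elim (x≢i refl)
searchRight-complete (right _ _ i∉l _) _ (inL p) = ⊥-elim (i∉l (RightSubAt-Contains p))
searchRight-complete {t = node l _ r} (right x≢i i≰x i∉l st) de (inR p) =
  trans (searchRight-right l r x≢i i≰x)
        (searchRight-complete st (map-suc-just (trans (sym (depthOf-right l r x≢i i∉l)) de)) p)

searchRight-sound : SearchTree i t → searchRight i t ≡ just s →
                    ∃ λ d → depthOf i t ≡ just d × RightSubAt i d t s
searchRight-sound {i} {node l _ r} here found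
  with refl ← trans (sym found) (searchRight-here i l r) =
  0 , depthOf-here i l r , root
searchRight-sound {t = node l _ r} (left x≢i i≤x i∉r st) found
  with d , de , p ← searchRight-sound st (trans (sym (searchRight-left l r x≢i i≤x)) found) =
  suc d , trans (depthOf-left l r x≢i i∉r) (cong (map suc) de) , inL p
searchRight-sound {t = node l _ r} (right x≢i i≰x i∉l st) found
  with d , de , p ← searchRight-sound st (trans (sym (searchRight-right l r x≢i i≰x)) found) =
  suc d , trans (depthOf-right l r x≢i i∉l) (cong (map suc) de) , inR p

searchRight-just⇔Contains : SearchTree i t → (∃ λ s → searchRight i t ≡ just s) ⇔ Contains i t
searchRight-just⇔Contains st =
  mk⇔ (λ (_ , found) → found⇒Contains st found) (Contains⇒found st)
  where
  found⇒Contains : SearchTree i t → searchRight i t ≡ just s → Contains i t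
  found⇒Contains st found with _ , _ , p ← searchRight-sound st found = RightSubAt-Contains p
  Contains⇒found : SearchTree i t → Contains i t → ∃ λ s → searchRight i t ≡ just s
  Contains⇒found {i} {node l _ r} here _ = r , searchRight-here i l r
  Contains⇒found (left x≢i _ _ _) root = ⊥-elim (x≢i refl)
  Contains⇒found {t = node l _ r} (left x≢i i≤x _ st) (inL c) =
    let s , found = Contains⇒found st c in s , trans (searchRight-left l r x≢i i≤x) found
  Contains⇒found (left _ _ i∉r _) (inR c) = ⊥-elim (i∉r c)
  Contains⇒found (right x≢i _ _ _) root = ⊥-elim (x≢i refl)
  Contains⇒found (right _ _ i∉l _) (inL c) = ⊥-elim (i∉l c)
  Contains⇒found {t = node l _ r} (right x≢i i≰x _ st) (inR c) =
    let s , found = Contains⇒found st c in s , trans (searchRight-right l r x≢i i≰x) found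

BInRightOfTop⇔searchRight : SearchTree i t →
  BInRightOfTop b i t ⇔ (∃ λ s → searchRight i t ≡ just s × Contains b s)
BInRightOfTop⇔searchRight st = mk⇔
  (λ (_ , s , de , p , c) → s , searchRight-complete st de p , c)
  (λ (s , found , c) → let d , de , p = searchRight-sound st found in d , s , de , p , c)

searchRight-insert-new : ∀ t → searchRight i t ≡ nothing → searchRight i (insert i t) ≡ just leaf
searchRight-insert-new {i} leaf _ = searchRight-here i leaf leaf
searchRight-insert-new {i} (node l x r) missing with x ≟ i | i ≤? x
... | yes refl | _ with () ← trans (sym missing) (searchRight-here i l r)
... | no x≢i | yes i≤x rewrite insert-≤ l r i≤x =
  trans (searchRight-left (insert i l) r x≢i i≤x)
        (searchRight-insert-new l (trans (sym (searchRight-left l r x≢i i≤x)) missing))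
... | no x≢i | no i≰x rewrite insert-≰ l r i≰x =
  trans (searchRight-right l (insert i r) x≢i i≰x)
        (searchRight-insert-new r (trans (sym (searchRight-right l r x≢i i≰x)) missing))

-- At a node x ≠ i, the letters i and i + 1 take the same branch.
searchRight-insert-suc : ∀ t → searchRight i t ≡ just s →
                         searchRight i (insert (suc i) t) ≡ just (insert (suc i) s)
searchRight-insert-suc {i} (node l x r) found with x ≟ i | i ≤? x
... | yes refl | _ with refl ← trans (sym found) (searchRight-here i l r)
  rewrite insert-≰ l r (<⇒≱ (n<1+n i)) = searchRight-here i l (insert (suc i) r)
... | no x≢i | yes i≤x rewrite insert-≤ l r (≤∧≢⇒< i≤x (x≢i ∘ sym)) =
  trans (searchRight-left (insert (suc i) l) r x≢i i≤x)
        (searchRight-insert-suc l (trans (sym (searchRight-left l r x≢i i≤x)) found))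
... | no x≢i | no i≰x rewrite insert-≰ l r (i≰x ∘ ≤-trans (n≤1+n i)) =
  trans (searchRight-right l (insert (suc i) r) x≢i i≰x)
        (searchRight-insert-suc r (trans (sym (searchRight-right l r x≢i i≰x)) found))

searchRight-insert : ∀ a t → searchRight i t ≡ just s →
  searchRight i (insert a t) ≡ just s ⊎ searchRight i (insert a t) ≡ just (insert a s)
searchRight-insert {i} a (node l x r) found with x ≟ i | i ≤? x | a ≤? x
... | yes refl | _ | yes a≤x with refl ← trans (sym found) (searchRight-here i l r)
  rewrite insert-≤ l r a≤x = inj₁ (searchRight-here i (insert a l) r)
... | yes refl | _ | no a≰x with refl ← trans (sym found) (searchRight-here i l r)
  rewrite insert-≰ l r a≰x = inj₂ (searchRight-here i l (insert a r))
... | no x≢i | yes i≤x | yes a≤x rewrite insert-≤ l r a≤x =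
  Data.Sum.map (trans (searchRight-left (insert a l) r x≢i i≤x))
               (trans (searchRight-left (insert a l) r x≢i i≤x))
               (searchRight-insert a l (trans (sym (searchRight-left l r x≢i i≤x)) found))
... | no x≢i | yes i≤x | no a≰x rewrite insert-≰ l r a≰x =
  inj₁ (trans (searchRight-left l (insert a r) x≢i i≤x)
              (trans (sym (searchRight-left l r x≢i i≤x)) found))
... | no x≢i | no i≰x | yes a≤x rewrite insert-≤ l r a≤x =
  inj₁ (trans (searchRight-right (insert a l) r x≢i i≰x)
              (trans (sym (searchRight-right l r x≢i i≰x)) found))
... | no x≢i | no i≰x | no a≰x rewrite insert-≰ l r a≰x =
  Data.Sum.map (trans (searchRight-right l (insert a r) x≢i i≰x))
               (trans (searchRight-right l (insert a r) x≢i i≰x))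
               (searchRight-insert a r (trans (sym (searchRight-right l r x≢i i≰x)) found))

replaceLeftmost-just⇔∈ : ∀ u → (∃ λ w → replaceLeftmost a b u ≡ just w) ⇔ a ∈ u
replaceLeftmost-just⇔∈ u = mk⇔ (to u) (from u)
  where
  to : ∀ u → (∃ λ w → replaceLeftmost a b u ≡ just w) → a ∈ u
  to {a} {b} (x ∷ u) replaced with x ≟ a
  ... | yes x≡a = here (sym x≡a)
  ... | no x≢a rewrite ≢⇒≡ᵇ-false x≢a with replaceLeftmost a b u in replaced-u | replaced
  ...   | just w | _ = there (to u (w , replaced-u))
  from : ∀ u → a ∈ u → ∃ λ w → replaceLeftmost a b u ≡ just w
  from {a} {b} (x ∷ u) a∈x∷u with x ≟ a | a∈x∷u
  ... | yes refl | _ rewrite ≡ᵇ-refl x = b ∷ u , refl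
  ... | no x≢a | here a≡x = ⊥-elim (x≢a (sym a≡x))
  ... | no x≢a | there a∈u rewrite ≢⇒≡ᵇ-false x≢a with w , replaced-u ← from {b = b} u a∈u =
    x ∷ w , cong (map (x ∷_)) replaced-u

ËDefined⇔∈×¬LeftOf : ∀ u → ËDefined i u ⇔ (suc i ∈ u × ¬ LeftOf (suc i) i u)
ËDefined⇔∈×¬LeftOf u = mk⇔
  (λ { (w , defined no-earlier replaced) →
        Equivalence.to (replaceLeftmost-just⇔∈ u) (w , replaced) , no-earlier })
  (λ (occurs , no-earlier) →
     let w , replaced = Equivalence.from (replaceLeftmost-just⇔∈ u) occurs in
     w , defined no-earlier replaced)

LeftOf-∈ : LeftOf a b (x ∷ u) → b ∈ u
LeftOf-∈ (here _ b∈u)              = b∈u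
LeftOf-∈ (there {u = _ ∷ _} later) = there (LeftOf-∈ later)

LeftOf-∷ : x ≢ a → LeftOf a b (x ∷ u) ⇔ LeftOf a b u
LeftOf-∷ x≢a = mk⇔ (λ { (here x≡a _) → ⊥-elim (x≢a x≡a) ; (there later) → later }) there

searchRight-rtree⇔∈ : ∀ u → (∃ λ s → searchRight i (rtree u) ≡ just s) ⇔ i ∈ u
searchRight-rtree⇔∈ u = rtree-Contains ⇔-∘ searchRight-just⇔Contains (rtree-SearchTree u)

searchRight-rtree-nothing : ∀ u → searchRight i (rtree u) ≡ nothing → ¬ i ∈ u
searchRight-rtree-nothing u missing i∈u
  with _ , found ← Equivalence.from (searchRight-rtree⇔∈ u) i∈u
  with () ← trans (sym missing) found

searchRight-rtree-LeftOf : ∀ u → searchRight i (rtree u) ≡ just s →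
                           Contains (suc i) s ⇔ LeftOf (suc i) i u
searchRight-rtree-LeftOf {i} (x ∷ u) found with searchRight i (rtree u) in found-u
... | nothing with x ≟ i
...   | yes refl with refl ← trans (sym found) (searchRight-insert-new (rtree u) found-u) =
  mk⇔ (λ ()) (⊥-elim ∘ searchRight-rtree-nothing u found-u ∘ LeftOf-∈)
...   | no x≢i with Equivalence.to (searchRight-rtree⇔∈ (x ∷ u)) (_ , found)
...     | here i≡x  = ⊥-elim (x≢i (sym i≡x))
...     | there i∈u = ⊥-elim (searchRight-rtree-nothing u found-u i∈u)
searchRight-rtree-LeftOf {i} (x ∷ u) found | just s₀ with x ≟ suc i
... | yes refl with refl ← trans (sym found) (searchRight-insert-suc (rtree u) found-u) =
  mk⇔ (λ _ → here refl (Equivalence.to (searchRight-rtree⇔∈ u) (s₀ , found-u)))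
      (λ _ → Equivalence.from (Contains-insert s₀) (inj₁ refl))
... | no x≢1+i =
  ⇔-sym (LeftOf-∷ x≢1+i) ⇔-∘ (searchRight-rtree-LeftOf u found-u ⇔-∘ subtree-unchanged)
  where
  subtree-unchanged : Contains (suc i) _ ⇔ Contains (suc i) s₀
  subtree-unchanged with searchRight-insert x (rtree u) found-u
  ... | inj₁ found₀ with refl ← trans (sym found) found₀ = ⇔-id _
  ... | inj₂ found₁ with refl ← trans (sym found) found₁ = Contains-insert-other (x≢1+i ∘ sym) s₀

LeftOf⇔BInRightOfTop : ∀ u → LeftOf (suc i) i u ⇔ BInRightOfTop (suc i) i (rtree u)
LeftOf⇔BInRightOfTop u =
  ⇔-sym (BInRightOfTop⇔searchRight (rtree-SearchTree u)) ⇔-∘ mk⇔ (to u) from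
  where
  to : ∀ u → LeftOf (suc i) i u → ∃ λ s → searchRight i (rtree u) ≡ just s × Contains (suc i) s
  to (x ∷ u) earlier
    with s , found ← Equivalence.from (searchRight-rtree⇔∈ (x ∷ u)) (there (LeftOf-∈ earlier)) =
    s , found , Equivalence.from (searchRight-rtree-LeftOf (x ∷ u) found) earlier
  from : (∃ λ s → searchRight i (rtree u) ≡ just s × Contains (suc i) s) → LeftOf (suc i) i u
  from (_ , found , c) = Equivalence.to (searchRight-rtree-LeftOf u found) c

lemma7 : (u : Word) → All (1 ≤_) u → (i : ℕ) →
    ËDefined i u ⇔ (Contains (suc i) (rtree u) × ¬ BInRightOfTop (suc i) i (rtree u))
lemma7 u _ i = (⇔-sym rtree-Contains ×-⇔ ¬-cong-⇔ (LeftOf⇔BInRightOfTop u)) ⇔-∘ ËDefined⇔∈×¬LeftOf u
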